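{- The Set-Fmla logic $\mathcal{PP}^{\Rightarrow_H}_{\le}$ is equivalential but not algebraizable. The set $\Xi(x,y)=\{x\Rightarrow y,\ y\Rightarrow x,\ \circ(x\Rightarrow y),\ \circ(y\Rightarrow x)\}$ is a set of equivalence formulas for it; equivalently, so is $\Xi(x,y)=\{\Delta(x\Rightarrow y),\Delta(y\Rightarrow x)\}$, where $\Delta x$ abbreviates $x\land\circ x$.
   Context: Let $\mathcal{V}_6=\{\hat{\mathbf f},\mathbf f,\mathbf n,\mathbf b,\mathbf t,\hat{\mathbf t}\}$, partially ordered as a bounded distributive lattice by $\hat{\mathbf f}<\mathbf f<\mathbf n<\mathbf t<\hat{\mathbf t}$ and $\mathbf f<\mathbf b<\mathbf t$, with $\mathbf n,\mathbf b$ incomparable. $\mathbf{PP}_6$ is the algebra on $\mathcal V_6$ in the signature $\{\land,\lor,{\sim},\circ,\bot,\top\}$ where $\land,\lor$ are meet and join, $\bot=\hat{\mathbf f}$, $\top=\hat{\mathbf t}$, ${\sim}$ swaps $\mathbf f\leftrightarrow\mathbf t$ and $\hat{\mathbf f}\leftrightarrow\hat{\mathbf t}$ and fixes $\mathbf n,\mathbf b$, and ${\circ}a=\hat{\mathbf t}$ if $a\in\{\hat{\mathbf f},\hat{\mathbf t}\}$, ${\circ}a=\hat{\mathbf f}$ otherwise. $\mathbf{PP}_6^{\Rightarrow_H}$ expands $\mathbf{PP}_6$ by $a\Rightarrow b=\max\{c: a\land c\le b\}$. $\mathcal{PP}^{\Rightarrow_H}_{\le}$ is the Set-Fmla logic over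 $\{\land,\lor,\Rightarrow,{\sim},\circ,\bot,\top\}$ with $\Phi\vdash\psi$ iff for some finite $\Phi'\subseteq\Phi$ the inequality $\bigwedge\Phi'\le\psi$ ($\bigwedge\varnothing=\top$) is valid in the variety generated by $\mathbf{PP}_6^{\Rightarrow_H}$. A Set-Fmla logic $\vdash$ is equivalential with set of equivalence formulas $\Xi(x,y)$ (a set of formulas in two variables) if for all formulas: $\vdash\Xi(\varphi,\varphi)$; $\varphi,\Xi(\varphi,\psi)\vdash\psi$; and for every $k$-ary connective $\copyright$, $\Xi(\varphi_1,\psi_1),\dots,\Xi(\varphi_k,\psi_k)\vdash\Xi(\copyright(\varphi_1,\dots,\varphi_k),\copyright(\psi_1,\dots,\psi_k))$. Algebraizable is meant in the sense of Blok and Pigozzi. -}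

module Defs where

open import Level using (Level; _⊔_) renaming (suc to lsuc; zero to lzero)
open import Data.Bool using (Bool; true; false; if_then_else_; _∧_; T)
open import Data.Nat using (ℕ; zero; suc)
open import Data.Fin using (Fin)
open import Data.Vec using (Vec; []; _∷_; lookup)
open import Data.List using (List; []; _∷_)
open import Data.List.Relation.Unary.All using (All)
open import Data.Unit using (⊤; tt)
open import Data.Empty using (⊥)
open import Data.Sum using (_⊎_)
open import Data.Product using (Σ; _×_; _,_)
open import Function.Bundles using (_⇔_)
open import Relation.Nullary using (¬_)
open import Relation.Binary.PropositionalEquality using (_≡_; refl)

data Op : Set where
  opAnd opOr opImp : Op
  opNeg opCirc : Op
  opBot opTop : Op

arity : Op → ℕ
arity opAnd  = 2
arity opOr   = 2
arity opImp  = 2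
arity opNeg  = 1
arity opCirc = 1
arity opBot  = 0
arity opTop  = 0

data Fm (V : Set) : Set where
  var : V → Fm V
  app : (o : Op) → Vec (Fm V) (arity o) → Fm V

module _ {V : Set} where
  _∧'_ _∨'_ _⇒'_ : Fm V → Fm V → Fm V
  infixr 6 _∧'_
  infixr 5 _∨'_
  infixr 4 _⇒'_
  φ ∧' ψ = app opAnd (φ ∷ ψ ∷ [])
  φ ∨' ψ = app opOr  (φ ∷ ψ ∷ [])
  φ ⇒' ψ = app opImp (φ ∷ ψ ∷ [])

  ∼' ∘' : Fm V → Fm V
  ∼' φ = app opNeg (φ ∷ [])
  ∘' φ = app opCirc (φ ∷ [])

  ⊥' ⊤' : Fm V
  ⊥' = app opBot []
  ⊤' = app opTop []

  Δ' : Fm V → Fm V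
  Δ' φ = φ ∧' ∘' φ


mutual
  sub : {V W : Set} → (V → Fm W) → Fm V → Fm W
  sub σ (var v)    = σ v
  sub σ (app o as) = app o (subs σ as)

  subs : {V W : Set} {k : ℕ} → (V → Fm W) → Vec (Fm V) k → Vec (Fm W) k
  subs σ []       = []
  subs σ (a ∷ as) = sub σ a ∷ subs σ as

record Algebra (ℓ : Level) : Set (lsuc ℓ) where
  field
    Carrier : Set ℓ
    op      : (o : Op) → Vec Carrier (arity o) → Carrier

module _ {ℓ : Level} (A : Algebra ℓ) where
  open Algebra A
  mutual
    eval : {V : Set} → (V → Carrier) → Fm V → Carrier
    eval h (var v)    = h v
    eval h (app o as) = op o (evals h as)

    evals : {V : Set} {k : ℕ} → (V → Carrier) → Vec (Fm V) k → Vec Carrier k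
    evals h []       = []
    evals h (a ∷ as) = eval h a ∷ evals h as

-- The six-element lattice V6 and the algebra PP6^{⇒H}
-- fh = f̂ (bottom), f, n, b, t, th = t̂ (top)

data V6 : Set where
  fh f n b t th : V6

-- the partial order: f̂ < f < n < t < t̂, f < b < t, n and b incomparable
leq : V6 → V6 → Bool
leq fh _  = true
leq _  th = true
leq _  fh = false
leq f  _  = true
leq n  n  = true
leq n  t  = true
leq b  b  = true
leq b  t  = true
leq t  t  = true
leq _  _  = false

_≤₆_ : V6 → V6 → Set
x ≤₆ y = T (leq x y)

-- meet and join (the only incomparable pair is n, b)
meet : V6 → V6 → V6
meet x y = if leq x y then x else (if leq y x then y else f)

join : V6 → V6 → V6
join x y = if leq x y then y else (if leq y x then x else t)

-- relative pseudo-complement x ⇒ y = max { z : x ∧ z ≤ y }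
-- (tabulated; correctness is checked in Sanity.imp-max below)
impTable : V6 → V6 → V6
impTable n f = b
impTable n b = b
impTable b f = n
impTable b n = n
impTable t f = f
impTable t n = n
impTable t b = b
impTable th f = f
impTable th n = n
impTable th b = b
impTable th t = t
impTable _ fh = fh
impTable _ _ = th

imp : V6 → V6 → V6
imp x y = if leq x y then th else impTable x y

neg : V6 → V6
neg fh = th
neg f  = t
neg n  = n
neg b  = b
neg t  = f
neg th = fh

circ : V6 → V6
circ fh = th
circ th = th
circ _  = fh

PP6H : Algebra lzero
PP6H = record { Carrier = V6 ; op = ops }
  where
  ops : (o : Op) → Vec V6 (arity o) → V6
  ops opAnd  (x ∷ y ∷ []) = meet x y
  ops opOr   (x ∷ y ∷ []) = join x y
  ops opImp  (x ∷ y ∷ []) = imp x y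
  ops opNeg  (x ∷ [])     = neg x
  ops opCirc (x ∷ [])     = circ x
  ops opBot  []           = fh
  ops opTop  []           = th

Pred : Set → Set₁
Pred A = A → Set

Form : Set
Form = Fm ℕ

-- Validity of the inequality φ ≤ ψ in the variety generated by PP6^{⇒H}
-- (equivalently: in PP6^{⇒H} itself, since H, S, P preserve equations and
-- φ ≤ ψ is the equation φ ∧ ψ ≈ φ).
ValidIneq : Form → Form → Set
ValidIneq φ ψ = (h : ℕ → V6) → eval PP6H h φ ≤₆ eval PP6H h ψ

bigMeet : List Form → Form
bigMeet []       = ⊤'
bigMeet (φ ∷ φs) = φ ∧' bigMeet φs

infix 3 _⊢_ _⊢*_
_⊢_ : Pred Form → Form → Set
Φ ⊢ ψ = Σ (List Form) λ Φ' → All Φ Φ' × ValidIneq (bigMeet Φ') ψ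

_⊢*_ : Pred Form → Pred Form → Set
Γ ⊢* Δ = (χ : Form) → Δ χ → Γ ⊢ χ

∅ : Pred Form
∅ _ = ⊥

｛_｝ : Form → Pred Form
｛ φ ｝ χ = χ ≡ φ

_∪_ : Pred Form → Pred Form → Pred Form
(Γ ∪ Δ) χ = Γ χ ⊎ Δ χ

pair : {W : Set} → Fm W → Fm W → Fin 2 → Fm W
pair φ ψ Fin.zero       = φ
pair φ ψ (Fin.suc _)    = ψ

_⟨_,_⟩ : Pred (Fm (Fin 2)) → Form → Form → Pred Form
(Ξ ⟨ φ , ψ ⟩) χ = Σ (Fm (Fin 2)) λ ξ → Ξ ξ × (χ ≡ sub (pair φ ψ) ξ)

IsEquivalenceSet : Pred (Fm (Fin 2)) → Set
IsEquivalenceSet Ξ =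
  ((φ : Form) → ∅ ⊢* Ξ ⟨ φ , φ ⟩) ×
  ((φ ψ : Form) → (｛ φ ｝ ∪ (Ξ ⟨ φ , ψ ⟩)) ⊢ ψ) ×
  ((o : Op) (φs ψs : Vec Form (arity o)) →
     (λ χ → Σ (Fin (arity o)) λ i → (Ξ ⟨ lookup φs i , lookup ψs i ⟩) χ)
       ⊢* Ξ ⟨ app o φs , app o ψs ⟩)

Equivalential : Set₁
Equivalential = Σ (Pred (Fm (Fin 2))) IsEquivalenceSet

X Y : Fm (Fin 2)
X = var Fin.zero
Y = var (Fin.suc Fin.zero)

Ξ₁ : Pred (Fm (Fin 2))
Ξ₁ ξ = (ξ ≡ (X ⇒' Y)) ⊎ (ξ ≡ (Y ⇒' X)) ⊎ (ξ ≡ ∘' (X ⇒' Y)) ⊎ (ξ ≡ ∘' (Y ⇒' X))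

Ξ₂ : Pred (Fm (Fin 2))
Ξ₂ ξ = (ξ ≡ Δ' (X ⇒' Y)) ⊎ (ξ ≡ Δ' (Y ⇒' X))

Eqn : Set → Set
Eqn V = Fm V × Fm V

module _ {ℓ ℓ' : Level} (K : Algebra ℓ → Set ℓ') where
  _⊨K_ : Pred (Eqn ℕ) → Eqn ℕ → Set (lsuc ℓ ⊔ ℓ')
  Θ ⊨K (s , u) =
    (A : Algebra ℓ) → K A → (h : ℕ → Algebra.Carrier A) →
    ((s' u' : Form) → Θ (s' , u') → eval A h s' ≡ eval A h u') →
    eval A h s ≡ eval A h u

  _⊨K*_ : Pred (Eqn ℕ) → Pred (Eqn ℕ) → Set (lsuc ℓ ⊔ ℓ')
  Θ ⊨K* Θ' = (e : Eqn ℕ) → Θ' e → Θ ⊨K e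

substEqn : Form → Eqn ⊤ → Eqn ℕ
substEqn φ (s , u) = sub (λ _ → φ) s , sub (λ _ → φ) u

_[_] : Pred (Eqn ⊤) → Pred Form → Pred (Eqn ℕ)
(E [ Γ ]) e = Σ Form λ γ → Γ γ × Σ (Eqn ⊤) λ ε → E ε × (e ≡ substEqn γ ε)

_[_⟨x,y⟩] : Pred (Eqn ⊤) → Pred (Fm (Fin 2)) → Pred (Eqn ℕ)
(E [ Δ ⟨x,y⟩]) e =
  Σ (Fm (Fin 2)) λ ξ → Δ ξ × Σ (Eqn ⊤) λ ε → E ε ×
    (e ≡ substEqn (sub (pair (var 0) (var 1)) ξ) ε)

Algebraizable : (ℓ ℓ' : Level) → Set (lsuc (ℓ ⊔ ℓ'))
Algebraizable ℓ ℓ' =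
  Σ (Algebra ℓ → Set ℓ') λ K →
  Σ (Pred (Eqn ⊤)) λ E →
  Σ (Pred (Fm (Fin 2))) λ Δ →
    ((Γ : Pred Form) (φ : Form) → (Γ ⊢ φ) ⇔ _⊨K*_ K (E [ Γ ]) (E [ ｛ φ ｝ ])) ×
    (_⊨K*_ K (λ e → e ≡ (var 0 , var 1)) (E [ Δ ⟨x,y⟩]) ×
     _⊨K*_ K (E [ Δ ⟨x,y⟩]) (λ e → e ≡ (var 0 , var 1)))

module Sanity where
  imp-max : ∀ x y z → leq z (imp x y) ≡ leq (meet x z) y
  imp-max fh fh fh = refl
  imp-max fh fh f = refl
  imp-max fh fh n = refl
  imp-max fh fh b = refl
  imp-max fh fh t = refl
  imp-max fh fh th = refl
  imp-max fh f fh = refl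
  imp-max fh f f = refl
  imp-max fh f n = refl
  imp-max fh f b = refl
  imp-max fh f t = refl
  imp-max fh f th = refl
  imp-max fh n fh = refl
  imp-max fh n f = refl
  imp-max fh n n = refl
  imp-max fh n b = refl
  imp-max fh n t = refl
  imp-max fh n th = refl
  imp-max fh b fh = refl
  imp-max fh b f = refl
  imp-max fh b n = refl
  imp-max fh b b = refl
  imp-max fh b t = refl
  imp-max fh b th = refl
  imp-max fh t fh = refl
  imp-max fh t f = refl
  imp-max fh t n = refl
  imp-max fh t b = refl
  imp-max fh t t = refl
  imp-max fh t th = refl
  imp-max fh th fh = refl
  imp-max fh th f = refl
  imp-max fh th n = refl
  imp-max fh th b = refl
  imp-max fh th t = refl
  imp-max fh th th = refl
  imp-max f fh fh = refl
  imp-max f fh f = refl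
  imp-max f fh n = refl
  imp-max f fh b = refl
  imp-max f fh t = refl
  imp-max f fh th = refl
  imp-max f f fh = refl
  imp-max f f f = refl
  imp-max f f n = refl
  imp-max f f b = refl
  imp-max f f t = refl
  imp-max f f th = refl
  imp-max f n fh = refl
  imp-max f n f = refl
  imp-max f n n = refl
  imp-max f n b = refl
  imp-max f n t = refl
  imp-max f n th = refl
  imp-max f b fh = refl
  imp-max f b f = refl
  imp-max f b n = refl
  imp-max f b b = refl
  imp-max f b t = refl
  imp-max f b th = refl
  imp-max f t fh = refl
  imp-max f t f = refl
  imp-max f t n = refl
  imp-max f t b = refl
  imp-max f t t = refl
  imp-max f t th = refl
  imp-max f th fh = refl
  imp-max f th f = refl
  imp-max f th n = refl
  imp-max f th b = refl
  imp-max f th t = refl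
  imp-max f th th = refl
  imp-max n fh fh = refl
  imp-max n fh f = refl
  imp-max n fh n = refl
  imp-max n fh b = refl
  imp-max n fh t = refl
  imp-max n fh th = refl
  imp-max n f fh = refl
  imp-max n f f = refl
  imp-max n f n = refl
  imp-max n f b = refl
  imp-max n f t = refl
  imp-max n f th = refl
  imp-max n n fh = refl
  imp-max n n f = refl
  imp-max n n n = refl
  imp-max n n b = refl
  imp-max n n t = refl
  imp-max n n th = refl
  imp-max n b fh = refl
  imp-max n b f = refl
  imp-max n b n = refl
  imp-max n b b = refl
  imp-max n b t = refl
  imp-max n b th = refl
  imp-max n t fh = refl
  imp-max n t f = refl
  imp-max n t n = refl
  imp-max n t b = refl
  imp-max n t t = refl
  imp-max n t th = refl
  imp-max n th fh = refl
  imp-max n th f = refl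
  imp-max n th n = refl
  imp-max n th b = refl
  imp-max n th t = refl
  imp-max n th th = refl
  imp-max b fh fh = refl
  imp-max b fh f = refl
  imp-max b fh n = refl
  imp-max b fh b = refl
  imp-max b fh t = refl
  imp-max b fh th = refl
  imp-max b f fh = refl
  imp-max b f f = refl
  imp-max b f n = refl
  imp-max b f b = refl
  imp-max b f t = refl
  imp-max b f th = refl
  imp-max b n fh = refl
  imp-max b n f = refl
  imp-max b n n = refl
  imp-max b n b = refl
  imp-max b n t = refl
  imp-max b n th = refl
  imp-max b b fh = refl
  imp-max b b f = refl
  imp-max b b n = refl
  imp-max b b b = refl
  imp-max b b t = refl
  imp-max b b th = refl
  imp-max b t fh = refl
  imp-max b t f = refl
  imp-max b t n = refl
  imp-max b t b = refl
  imp-max b t t = refl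
  imp-max b t th = refl
  imp-max b th fh = refl
  imp-max b th f = refl
  imp-max b th n = refl
  imp-max b th b = refl
  imp-max b th t = refl
  imp-max b th th = refl
  imp-max t fh fh = refl
  imp-max t fh f = refl
  imp-max t fh n = refl
  imp-max t fh b = refl
  imp-max t fh t = refl
  imp-max t fh th = refl
  imp-max t f fh = refl
  imp-max t f f = refl
  imp-max t f n = refl
  imp-max t f b = refl
  imp-max t f t = refl
  imp-max t f th = refl
  imp-max t n fh = refl
  imp-max t n f = refl
  imp-max t n n = refl
  imp-max t n b = refl
  imp-max t n t = refl
  imp-max t n th = refl
  imp-max t b fh = refl
  imp-max t b f = refl
  imp-max t b n = refl
  imp-max t b b = refl
  imp-max t b t = refl
  imp-max t b th = refl
  imp-max t t fh = refl
  imp-max t t f = refl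
  imp-max t t n = refl
  imp-max t t b = refl
  imp-max t t t = refl
  imp-max t t th = refl
  imp-max t th fh = refl
  imp-max t th f = refl
  imp-max t th n = refl
  imp-max t th b = refl
  imp-max t th t = refl
  imp-max t th th = refl
  imp-max th fh fh = refl
  imp-max th fh f = refl
  imp-max th fh n = refl
  imp-max th fh b = refl
  imp-max th fh t = refl
  imp-max th fh th = refl
  imp-max th f fh = refl
  imp-max th f f = refl
  imp-max th f n = refl
  imp-max th f b = refl
  imp-max th f t = refl
  imp-max th f th = refl
  imp-max th n fh = refl
  imp-max th n f = refl
  imp-max th n n = refl
  imp-max th n b = refl
  imp-max th n t = refl
  imp-max th n th = refl
  imp-max th b fh = refl
  imp-max th b f = refl
  imp-max th b n = refl
  imp-max th b b = refl
  imp-max th b t = refl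
  imp-max th b th = refl
  imp-max th t fh = refl
  imp-max th t f = refl
  imp-max th t n = refl
  imp-max th t b = refl
  imp-max th t t = refl
  imp-max th t th = refl
  imp-max th th fh = refl
  imp-max th th f = refl
  imp-max th th n = refl
  imp-max th th b = refl
  imp-max th th t = refl
  imp-max th th th = refl
  meet-glb : ∀ x y z → leq z (meet x y) ≡ (leq z x ∧ leq z y)
  meet-glb fh fh fh = refl
  meet-glb fh fh f = refl
  meet-glb fh fh n = refl
  meet-glb fh fh b = refl
  meet-glb fh fh t = refl
  meet-glb fh fh th = refl
  meet-glb fh f fh = refl
  meet-glb fh f f = refl
  meet-glb fh f n = refl
  meet-glb fh f b = refl
  meet-glb fh f t = refl
  meet-glb fh f th = refl
  meet-glb fh n fh = refl
  meet-glb fh n f = refl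
  meet-glb fh n n = refl
  meet-glb fh n b = refl
  meet-glb fh n t = refl
  meet-glb fh n th = refl
  meet-glb fh b fh = refl
  meet-glb fh b f = refl
  meet-glb fh b n = refl
  meet-glb fh b b = refl
  meet-glb fh b t = refl
  meet-glb fh b th = refl
  meet-glb fh t fh = refl
  meet-glb fh t f = refl
  meet-glb fh t n = refl
  meet-glb fh t b = refl
  meet-glb fh t t = refl
  meet-glb fh t th = refl
  meet-glb fh th fh = refl
  meet-glb fh th f = refl
  meet-glb fh th n = refl
  meet-glb fh th b = refl
  meet-glb fh th t = refl
  meet-glb fh th th = refl
  meet-glb f fh fh = refl
  meet-glb f fh f = refl
  meet-glb f fh n = refl
  meet-glb f fh b = refl
  meet-glb f fh t = refl
  meet-glb f fh th = refl
  meet-glb f f fh = refl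
  meet-glb f f f = refl
  meet-glb f f n = refl
  meet-glb f f b = refl
  meet-glb f f t = refl
  meet-glb f f th = refl
  meet-glb f n fh = refl
  meet-glb f n f = refl
  meet-glb f n n = refl
  meet-glb f n b = refl
  meet-glb f n t = refl
  meet-glb f n th = refl
  meet-glb f b fh = refl
  meet-glb f b f = refl
  meet-glb f b n = refl
  meet-glb f b b = refl
  meet-glb f b t = refl
  meet-glb f b th = refl
  meet-glb f t fh = refl
  meet-glb f t f = refl
  meet-glb f t n = refl
  meet-glb f t b = refl
  meet-glb f t t = refl
  meet-glb f t th = refl
  meet-glb f th fh = refl
  meet-glb f th f = refl
  meet-glb f th n = refl
  meet-glb f th b = refl
  meet-glb f th t = refl
  meet-glb f th th = refl
  meet-glb n fh fh = refl
  meet-glb n fh f = refl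
  meet-glb n fh n = refl
  meet-glb n fh b = refl
  meet-glb n fh t = refl
  meet-glb n fh th = refl
  meet-glb n f fh = refl
  meet-glb n f f = refl
  meet-glb n f n = refl
  meet-glb n f b = refl
  meet-glb n f t = refl
  meet-glb n f th = refl
  meet-glb n n fh = refl
  meet-glb n n f = refl
  meet-glb n n n = refl
  meet-glb n n b = refl
  meet-glb n n t = refl
  meet-glb n n th = refl
  meet-glb n b fh = refl
  meet-glb n b f = refl
  meet-glb n b n = refl
  meet-glb n b b = refl
  meet-glb n b t = refl
  meet-glb n b th = refl
  meet-glb n t fh = refl
  meet-glb n t f = refl
  meet-glb n t n = refl
  meet-glb n t b = refl
  meet-glb n t t = refl
  meet-glb n t th = refl
  meet-glb n th fh = refl
  meet-glb n th f = refl
  meet-glb n th n = refl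
  meet-glb n th b = refl
  meet-glb n th t = refl
  meet-glb n th th = refl
  meet-glb b fh fh = refl
  meet-glb b fh f = refl
  meet-glb b fh n = refl
  meet-glb b fh b = refl
  meet-glb b fh t = refl
  meet-glb b fh th = refl
  meet-glb b f fh = refl
  meet-glb b f f = refl
  meet-glb b f n = refl
  meet-glb b f b = refl
  meet-glb b f t = refl
  meet-glb b f th = refl
  meet-glb b n fh = refl
  meet-glb b n f = refl
  meet-glb b n n = refl
  meet-glb b n b = refl
  meet-glb b n t = refl
  meet-glb b n th = refl
  meet-glb b b fh = refl
  meet-glb b b f = refl
  meet-glb b b n = refl
  meet-glb b b b = refl
  meet-glb b b t = refl
  meet-glb b b th = refl
  meet-glb b t fh = refl
  meet-glb b t f = refl
  meet-glb b t n = refl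
  meet-glb b t b = refl
  meet-glb b t t = refl
  meet-glb b t th = refl
  meet-glb b th fh = refl
  meet-glb b th f = refl
  meet-glb b th n = refl
  meet-glb b th b = refl
  meet-glb b th t = refl
  meet-glb b th th = refl
  meet-glb t fh fh = refl
  meet-glb t fh f = refl
  meet-glb t fh n = refl
  meet-glb t fh b = refl
  meet-glb t fh t = refl
  meet-glb t fh th = refl
  meet-glb t f fh = refl
  meet-glb t f f = refl
  meet-glb t f n = refl
  meet-glb t f b = refl
  meet-glb t f t = refl
  meet-glb t f th = refl
  meet-glb t n fh = refl
  meet-glb t n f = refl
  meet-glb t n n = refl
  meet-glb t n b = refl
  meet-glb t n t = refl
  meet-glb t n th = refl
  meet-glb t b fh = refl
  meet-glb t b f = refl
  meet-glb t b n = refl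
  meet-glb t b b = refl
  meet-glb t b t = refl
  meet-glb t b th = refl
  meet-glb t t fh = refl
  meet-glb t t f = refl
  meet-glb t t n = refl
  meet-glb t t b = refl
  meet-glb t t t = refl
  meet-glb t t th = refl
  meet-glb t th fh = refl
  meet-glb t th f = refl
  meet-glb t th n = refl
  meet-glb t th b = refl
  meet-glb t th t = refl
  meet-glb t th th = refl
  meet-glb th fh fh = refl
  meet-glb th fh f = refl
  meet-glb th fh n = refl
  meet-glb th fh b = refl
  meet-glb th fh t = refl
  meet-glb th fh th = refl
  meet-glb th f fh = refl
  meet-glb th f f = refl
  meet-glb th f n = refl
  meet-glb th f b = refl
  meet-glb th f t = refl
  meet-glb th f th = refl
  meet-glb th n fh = refl
  meet-glb th n f = refl
  meet-glb th n n = refl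
  meet-glb th n b = refl
  meet-glb th n t = refl
  meet-glb th n th = refl
  meet-glb th b fh = refl
  meet-glb th b f = refl
  meet-glb th b n = refl
  meet-glb th b b = refl
  meet-glb th b t = refl
  meet-glb th b th = refl
  meet-glb th t fh = refl
  meet-glb th t f = refl
  meet-glb th t n = refl
  meet-glb th t b = refl
  meet-glb th t t = refl
  meet-glb th t th = refl
  meet-glb th th fh = refl
  meet-glb th th f = refl
  meet-glb th th n = refl
  meet-glb th th b = refl
  meet-glb th th t = refl
  meet-glb th th th = refl
  join-lub : ∀ x y z → leq (join x y) z ≡ (leq x z ∧ leq y z)
  join-lub fh fh fh = refl
  join-lub fh fh f = refl
  join-lub fh fh n = refl
  join-lub fh fh b = refl
  join-lub fh fh t = refl
  join-lub fh fh th = refl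
  join-lub fh f fh = refl
  join-lub fh f f = refl
  join-lub fh f n = refl
  join-lub fh f b = refl
  join-lub fh f t = refl
  join-lub fh f th = refl
  join-lub fh n fh = refl
  join-lub fh n f = refl
  join-lub fh n n = refl
  join-lub fh n b = refl
  join-lub fh n t = refl
  join-lub fh n th = refl
  join-lub fh b fh = refl
  join-lub fh b f = refl
  join-lub fh b n = refl
  join-lub fh b b = refl
  join-lub fh b t = refl
  join-lub fh b th = refl
  join-lub fh t fh = refl
  join-lub fh t f = refl
  join-lub fh t n = refl
  join-lub fh t b = refl
  join-lub fh t t = refl
  join-lub fh t th = refl
  join-lub fh th fh = refl
  join-lub fh th f = refl
  join-lub fh th n = refl
  join-lub fh th b = refl
  join-lub fh th t = refl
  join-lub fh th th = refl
  join-lub f fh fh = refl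
  join-lub f fh f = refl
  join-lub f fh n = refl
  join-lub f fh b = refl
  join-lub f fh t = refl
  join-lub f fh th = refl
  join-lub f f fh = refl
  join-lub f f f = refl
  join-lub f f n = refl
  join-lub f f b = refl
  join-lub f f t = refl
  join-lub f f th = refl
  join-lub f n fh = refl
  join-lub f n f = refl
  join-lub f n n = refl
  join-lub f n b = refl
  join-lub f n t = refl
  join-lub f n th = refl
  join-lub f b fh = refl
  join-lub f b f = refl
  join-lub f b n = refl
  join-lub f b b = refl
  join-lub f b t = refl
  join-lub f b th = refl
  join-lub f t fh = refl
  join-lub f t f = refl
  join-lub f t n = refl
  join-lub f t b = refl
  join-lub f t t = refl
  join-lub f t th = refl
  join-lub f th fh = refl
  join-lub f th f = refl
  join-lub f th n = refl
  join-lub f th b = refl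
  join-lub f th t = refl
  join-lub f th th = refl
  join-lub n fh fh = refl
  join-lub n fh f = refl
  join-lub n fh n = refl
  join-lub n fh b = refl
  join-lub n fh t = refl
  join-lub n fh th = refl
  join-lub n f fh = refl
  join-lub n f f = refl
  join-lub n f n = refl
  join-lub n f b = refl
  join-lub n f t = refl
  join-lub n f th = refl
  join-lub n n fh = refl
  join-lub n n f = refl
  join-lub n n n = refl
  join-lub n n b = refl
  join-lub n n t = refl
  join-lub n n th = refl
  join-lub n b fh = refl
  join-lub n b f = refl
  join-lub n b n = refl
  join-lub n b b = refl
  join-lub n b t = refl
  join-lub n b th = refl
  join-lub n t fh = refl
  join-lub n t f = refl
  join-lub n t n = refl
  join-lub n t b = refl
  join-lub n t t = refl
  join-lub n t th = refl
  join-lub n th fh = refl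
  join-lub n th f = refl
  join-lub n th n = refl
  join-lub n th b = refl
  join-lub n th t = refl
  join-lub n th th = refl
  join-lub b fh fh = refl
  join-lub b fh f = refl
  join-lub b fh n = refl
  join-lub b fh b = refl
  join-lub b fh t = refl
  join-lub b fh th = refl
  join-lub b f fh = refl
  join-lub b f f = refl
  join-lub b f n = refl
  join-lub b f b = refl
  join-lub b f t = refl
  join-lub b f th = refl
  join-lub b n fh = refl
  join-lub b n f = refl
  join-lub b n n = refl
  join-lub b n b = refl
  join-lub b n t = refl
  join-lub b n th = refl
  join-lub b b fh = refl
  join-lub b b f = refl
  join-lub b b n = refl
  join-lub b b b = refl
  join-lub b b t = refl
  join-lub b b th = refl
  join-lub b t fh = refl
  join-lub b t f = refl
  join-lub b t n = refl
  join-lub b t b = refl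
  join-lub b t t = refl
  join-lub b t th = refl
  join-lub b th fh = refl
  join-lub b th f = refl
  join-lub b th n = refl
  join-lub b th b = refl
  join-lub b th t = refl
  join-lub b th th = refl
  join-lub t fh fh = refl
  join-lub t fh f = refl
  join-lub t fh n = refl
  join-lub t fh b = refl
  join-lub t fh t = refl
  join-lub t fh th = refl
  join-lub t f fh = refl
  join-lub t f f = refl
  join-lub t f n = refl
  join-lub t f b = refl
  join-lub t f t = refl
  join-lub t f th = refl
  join-lub t n fh = refl
  join-lub t n f = refl
  join-lub t n n = refl
  join-lub t n b = refl
  join-lub t n t = refl
  join-lub t n th = refl
  join-lub t b fh = refl
  join-lub t b f = refl
  join-lub t b n = refl
  join-lub t b b = refl
  join-lub t b t = refl
  join-lub t b th = refl
  join-lub t t fh = refl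
  join-lub t t f = refl
  join-lub t t n = refl
  join-lub t t b = refl
  join-lub t t t = refl
  join-lub t t th = refl
  join-lub t th fh = refl
  join-lub t th f = refl
  join-lub t th n = refl
  join-lub t th b = refl
  join-lub t th t = refl
  join-lub t th th = refl
  join-lub th fh fh = refl
  join-lub th fh f = refl
  join-lub th fh n = refl
  join-lub th fh b = refl
  join-lub th fh t = refl
  join-lub th fh th = refl
  join-lub th f fh = refl
  join-lub th f f = refl
  join-lub th f n = refl
  join-lub th f b = refl
  join-lub th f t = refl
  join-lub th f th = refl
  join-lub th n fh = refl
  join-lub th n f = refl
  join-lub th n n = refl
  join-lub th n b = refl
  join-lub th n t = refl
  join-lub th n th = refl
  join-lub th b fh = refl
  join-lub th b f = refl
  join-lub th b n = refl
  join-lub th b b = refl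
  join-lub th b t = refl
  join-lub th b th = refl
  join-lub th t fh = refl
  join-lub th t f = refl
  join-lub th t n = refl
  join-lub th t b = refl
  join-lub th t t = refl
  join-lub th t th = refl
  join-lub th th fh = refl
  join-lub th th f = refl
  join-lub th th n = refl
  join-lub th th b = refl
  join-lub th th t = refl
  join-lub th th th = refl

-- In PP6^{⇒H}, Δ(a ⇒ c) is t̂ if a ≤ c and f̂ otherwise, so for either Ξ the meet of Ξ(a, c)
-- is t̂ if a = c and f̂ otherwise. A common lower bound of premises Ξ(φᵢ, ψᵢ) is therefore f̂,
-- or else the valuation identifies every φᵢ with ψᵢ; this gives detachment and congruence.
-- If E(x) and Δ(x, y) algebraized the logic, then Δ(E(x)) ⊢ x, and x ⊢ ⋀Ξ(s(x), u(x)) for every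
-- s ≈ u in E, since ⊢ ⋀Ξ(s, s). Evaluated at x = n, which lies above f̂, the latter gives
-- s(n) = u(n); as ⊢ Δ(x, x), every member of Δ(E(x)) is then t̂ at n, but x is not.

module Submission where

open import Defs
open import Level using (Level)
open import Data.Bool using (T)
open import Data.Bool.Properties using (T-∧)
open import Data.Fin using (Fin; zero; suc)
open import Data.List using (List; []; _∷_; _++_; map; foldr)
open import Data.List.Membership.Propositional using (_∈_)
open import Data.List.Relation.Unary.Any using (here; there)
open import Data.List.Relation.Unary.All as All using (All; []; _∷_; all?)
open import Data.List.Relation.Unary.All.Properties using (map⁺; map⁻; ++⁺; ++⁻)
open import Data.Nat as ℕ using (ℕ)
open import Data.Product using (Σ; _×_; _,_; proj₁; proj₂)
open import Data.Sum using (_⊎_; inj₁; inj₂; [_,_]′; map₁)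
open import Data.Unit using (⊤; tt)
open import Data.Empty using (⊥)
open import Data.Vec using (Vec; []; _∷_; lookup)
open import Function using (_∘_; id)
open import Function.Bundles using (_⇔_; Equivalence; mk↣)
open import Relation.Binary.Definitions using (DecidableEquality)
open import Relation.Binary.PropositionalEquality using (_≡_; refl; sym; trans; cong; cong₂; subst)
open import Relation.Nullary using (¬_; Dec)
open import Relation.Nullary.Decidable
  using (map′; from-yes; T?; _⊎-dec_; _×-dec_; _→-dec_; via-injection)
open import Relation.Unary using (_≐_)

module _ {ℓ : Level} (A : Algebra ℓ) where
  open Algebra A

  mutual
    eval-sub : {V W : Set} {σ : V → Fm W} {h : W → Carrier} {g : V → Carrier} →
               (∀ v → eval A h (σ v) ≡ g v) → ∀ φ → eval A h (sub σ φ) ≡ eval A g φ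
    eval-sub σh≗g (var v)    = σh≗g v
    eval-sub σh≗g (app o φs) = cong (op o) (evals-sub σh≗g φs)

    evals-sub : {V W : Set} {σ : V → Fm W} {h : W → Carrier} {g : V → Carrier} →
                (∀ v → eval A h (σ v) ≡ g v) →
                ∀ {k} (φs : Vec (Fm V) k) → evals A h (subs σ φs) ≡ evals A g φs
    evals-sub σh≗g []       = refl
    evals-sub σh≗g (φ ∷ φs) = cong₂ _∷_ (eval-sub σh≗g φ) (evals-sub σh≗g φs)

  eval-sub-cong : {V W : Set} {σ τ : V → Fm W} {h g : W → Carrier} →
                  (∀ v → eval A h (σ v) ≡ eval A g (τ v)) →
                  ∀ φ → eval A h (sub σ φ) ≡ eval A g (sub τ φ)
  eval-sub-cong σh≗τg φ = trans (eval-sub σh≗τg φ) (sym (eval-sub (λ _ → refl) φ))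

  eval-pair-cong : {h g : ℕ → Carrier} {φ ψ φ′ ψ′ : Form} →
                   eval A h φ ≡ eval A g φ′ → eval A h ψ ≡ eval A g ψ′ →
                   ∀ χ → eval A h (sub (pair φ ψ) χ) ≡ eval A g (sub (pair φ′ ψ′) χ)
  eval-pair-cong φ≡φ′ ψ≡ψ′ = eval-sub-cong λ { zero → φ≡φ′ ; (suc _) → ψ≡ψ′ }

  Holds : (ℕ → Carrier) → Eqn ℕ → Set ℓ
  Holds h (s , u) = eval A h s ≡ eval A h u

  substEqn-respects : {h g : ℕ → Carrier} (φ ψ : Form) (ε : Eqn ⊤) → eval A h φ ≡ eval A g ψ →
                      Holds h (substEqn φ ε) → Holds g (substEqn ψ ε)
  substEqn-respects _ _ (s , u) φ≡ψ holds =
    trans (sym (eval-sub-cong (λ _ → φ≡ψ) s)) (trans holds (eval-sub-cong (λ _ → φ≡ψ) u))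

elements : List V6
elements = fh ∷ f ∷ n ∷ b ∷ t ∷ th ∷ []

∈-elements : ∀ x → x ∈ elements
∈-elements fh = here refl
∈-elements f  = there (here refl)
∈-elements n  = there (there (here refl))
∈-elements b  = there (there (there (here refl)))
∈-elements t  = there (there (there (there (here refl))))
∈-elements th = there (there (there (there (there (here refl)))))

-- Universal statements about V6 are proved below as from-yes (∀? …), by exhaustive evaluation.
∀? : {P : V6 → Set} → (∀ x → Dec (P x)) → Dec (∀ x → P x)
∀? P? = map′ (λ all x → All.lookup all (∈-elements x)) (λ all → All.tabulate λ {x} _ → all x)
             (all? P? elements)

index : V6 → ℕ
index fh = 0
index f  = 1
index n  = 2
index b  = 3
index t  = 4
index th = 5

fromIndex : ℕ → V6
fromIndex 0 = fh
fromIndex 1 = f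
fromIndex 2 = n
fromIndex 3 = b
fromIndex 4 = t
fromIndex _ = th

fromIndex-index : ∀ x → fromIndex (index x) ≡ x
fromIndex-index fh = refl
fromIndex-index f  = refl
fromIndex-index n  = refl
fromIndex-index b  = refl
fromIndex-index t  = refl
fromIndex-index th = refl

_≟₆_ : DecidableEquality V6
_≟₆_ = via-injection (mk↣ index-injective) ℕ._≟_
  where
  index-injective : ∀ {x y} → index x ≡ index y → x ≡ y
  index-injective {x} {y} eq =
    trans (sym (fromIndex-index x)) (trans (cong fromIndex eq) (fromIndex-index y))

_≤₆?_ : ∀ x y → Dec (x ≤₆ y)
x ≤₆? y = T? (leq x y)

≤₆-refl : ∀ x → x ≤₆ x
≤₆-refl = from-yes (∀? λ x → x ≤₆? x)

≤₆-trans : ∀ {x y z} → x ≤₆ y → y ≤₆ z → x ≤₆ z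
≤₆-trans {x} {y} {z} =
  from-yes (∀? λ x → ∀? λ y → ∀? λ z → x ≤₆? y →-dec y ≤₆? z →-dec x ≤₆? z) x y z

≤₆-th : ∀ x → x ≤₆ th
≤₆-th = from-yes (∀? λ x → x ≤₆? th)

≤₆fh⇒≤₆ : ∀ {z x} → z ≤₆ fh → z ≤₆ x
≤₆fh⇒≤₆ z≤fh = ≤₆-trans z≤fh tt

≤₆-meet : ∀ {z x y} → z ≤₆ meet x y ⇔ (z ≤₆ x × z ≤₆ y)
≤₆-meet {z} {x} {y} = subst (λ β → T β ⇔ (z ≤₆ x × z ≤₆ y)) (sym (Sanity.meet-glb x y z)) T-∧

conj : {V : Set} → List (Fm V) → Fm V
conj = foldr _∧'_ ⊤'

bigMeet≡conj : ∀ Φ → bigMeet Φ ≡ conj Φ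
bigMeet≡conj []      = refl
bigMeet≡conj (φ ∷ Φ) = cong (φ ∧'_) (bigMeet≡conj Φ)

module _ {V : Set} {h : V → V6} {z : V6} where

  ≤₆-conj⁺ : ∀ {Φ} → All (λ φ → z ≤₆ eval PP6H h φ) Φ → z ≤₆ eval PP6H h (conj Φ)
  ≤₆-conj⁺ []       = ≤₆-th z
  ≤₆-conj⁺ (p ∷ ps) = Equivalence.from ≤₆-meet (p , ≤₆-conj⁺ ps)

  ≤₆-conj⁻ : ∀ Φ → z ≤₆ eval PP6H h (conj Φ) → All (λ φ → z ≤₆ eval PP6H h φ) Φ
  ≤₆-conj⁻ []      _ = []
  ≤₆-conj⁻ (φ ∷ Φ) p = proj₁ p₁₂ ∷ ≤₆-conj⁻ Φ (proj₂ p₁₂)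
    where p₁₂ = Equivalence.to ≤₆-meet p

⊢-intro : ∀ {Γ} ψ (L : List Form) → All Γ L →
          (∀ h {z} → All (λ γ → z ≤₆ eval PP6H h γ) L → z ≤₆ eval PP6H h ψ) → Γ ⊢ ψ
⊢-intro ψ L Γ-L bound = L , Γ-L , λ h →
  let z = eval PP6H h (bigMeet L)
  in bound h (≤₆-conj⁻ L (subst (λ χ → z ≤₆ eval PP6H h χ) (bigMeet≡conj L) (≤₆-refl z)))

⊢-lowerBound : ∀ {Γ} ψ → Γ ⊢ ψ →
               ∀ h {z} → (∀ {γ} → Γ γ → z ≤₆ eval PP6H h γ) → z ≤₆ eval PP6H h ψ
⊢-lowerBound ψ (L , Γ-L , valid) h {z} bound = ≤₆-trans z≤⋀L (valid h)
  where
  z≤⋀L : z ≤₆ eval PP6H h (bigMeet L)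
  z≤⋀L = subst (λ χ → z ≤₆ eval PP6H h χ) (sym (bigMeet≡conj L)) (≤₆-conj⁺ (All.map bound Γ-L))

⟦_⟧ : Fm (Fin 2) → V6 → V6 → V6
⟦ ξ ⟧ a c = eval PP6H (lookup (a ∷ c ∷ [])) ξ

eval-instance : ∀ {h : ℕ → V6} {φ ψ : Form} ξ →
                eval PP6H h (sub (pair φ ψ) ξ) ≡ ⟦ ξ ⟧ (eval PP6H h φ) (eval PP6H h ψ)
eval-instance = eval-sub PP6H λ { zero → refl ; (suc zero) → refl }

record IsEqualityIndicator (ξs : List (Fm (Fin 2))) : Set where
  field
    diagonal  : ∀ c → th ≤₆ ⟦ conj ξs ⟧ c c
    separates : ∀ a c → ⟦ conj ξs ⟧ a c ≡ fh ⊎ a ≡ c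

isEqualityIndicator? : ∀ ξs → Dec (IsEqualityIndicator ξs)
isEqualityIndicator? ξs =
  map′ (λ (d , s) → record { diagonal = d ; separates = s })
       (λ ind → IsEqualityIndicator.diagonal ind , IsEqualityIndicator.separates ind)
       (∀? (λ c → th ≤₆? ⟦ conj ξs ⟧ c c) ×-dec
        ∀? λ a → ∀? λ c → (⟦ conj ξs ⟧ a c ≟₆ fh) ⊎-dec (a ≟₆ c))

module EqualityIndicator {ξs : List (Fm (Fin 2))} (indicator : IsEqualityIndicator ξs) where
  open IsEqualityIndicator indicator

  diagonal-member : ∀ {ξ} → ξ ∈ ξs → ∀ c → th ≤₆ ⟦ ξ ⟧ c c
  diagonal-member ξ∈ξs c = All.lookup (≤₆-conj⁻ ξs (diagonal c)) ξ∈ξs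

  ⊢conj-diagonal : ∀ φ → ∅ ⊢ sub (pair φ φ) (conj ξs)
  ⊢conj-diagonal φ = ⊢-intro (sub (pair φ φ) (conj ξs)) [] [] λ h _ →
    ≤₆-trans (≤₆-th _) (subst (th ≤₆_) (sym (eval-instance (conj ξs))) (diagonal _))

  below-separates : ∀ {z a c} → z ≤₆ ⟦ conj ξs ⟧ a c → z ≤₆ fh ⊎ a ≡ c
  below-separates {z} {a} {c} z≤ = map₁ (λ ≡fh → subst (z ≤₆_) ≡fh z≤) (separates a c)

  instances : Form → Form → List Form
  instances φ ψ = map (sub (pair φ ψ)) ξs

  ≤₆-instances : ∀ {h z φ ψ} → All (λ γ → z ≤₆ eval PP6H h γ) (instances φ ψ) →
                 z ≤₆ ⟦ conj ξs ⟧ (eval PP6H h φ) (eval PP6H h ψ)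
  ≤₆-instances {z = z} bounds =
    ≤₆-conj⁺ (All.map (λ {ξ} → subst (z ≤₆_) (eval-instance ξ)) (map⁻ bounds))

module EquivalenceSet {Ξ : Pred (Fm (Fin 2))} {ξs : List (Fm (Fin 2))}
                      (Ξ≐ξs : Ξ ≐ (_∈ ξs)) (indicator : IsEqualityIndicator ξs) where
  open EqualityIndicator indicator

  instances-⊆ : ∀ φ ψ → All (Ξ ⟨ φ , ψ ⟩) (instances φ ψ)
  instances-⊆ φ ψ = map⁺ (All.tabulate λ ξ∈ξs → _ , proj₂ Ξ≐ξs ξ∈ξs , refl)

  diagonal-instance : ∀ {h ξ φ ψ} → Ξ ξ → eval PP6H h φ ≡ eval PP6H h ψ →
                      th ≤₆ eval PP6H h (sub (pair φ ψ) ξ)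
  diagonal-instance {h} {ξ} {φ} Ξξ φ≡ψ =
    subst (th ≤₆_) (sym (trans (eval-instance ξ) (cong (⟦ ξ ⟧ (eval PP6H h φ)) (sym φ≡ψ))))
          (diagonal-member (proj₁ Ξ≐ξs Ξξ) _)

  reflexive : ∀ φ → ∅ ⊢* Ξ ⟨ φ , φ ⟩
  reflexive φ _ (ξ , Ξξ , refl) = ⊢-intro (sub (pair φ φ) ξ) [] [] λ h _ →
    ≤₆-trans (≤₆-th _) (diagonal-instance Ξξ refl)

  detachment : ∀ φ ψ → (｛ φ ｝ ∪ (Ξ ⟨ φ , ψ ⟩)) ⊢ ψ
  detachment φ ψ = ⊢-intro ψ (φ ∷ instances φ ψ) (inj₁ refl ∷ All.map inj₂ (instances-⊆ φ ψ))
    λ { h (z≤φ ∷ bounds) →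
          [ ≤₆fh⇒≤₆ , (λ φ≡ψ → subst (_ ≤₆_) φ≡ψ z≤φ) ]′ (below-separates (≤₆-instances bounds)) }

  argInstances : ∀ {k} → Vec Form k → Vec Form k → List Form
  argInstances []       []       = []
  argInstances (φ ∷ φs) (ψ ∷ ψs) = instances φ ψ ++ argInstances φs ψs

  argInstances-⊆ : ∀ {k} {P : Pred Form} (φs ψs : Vec Form k) →
                   (∀ i {χ} → (Ξ ⟨ lookup φs i , lookup ψs i ⟩) χ → P χ) →
                   All P (argInstances φs ψs)
  argInstances-⊆ []       []       _  = []
  argInstances-⊆ (φ ∷ φs) (ψ ∷ ψs) ⊆P =
    ++⁺ (All.map (⊆P zero) (instances-⊆ φ ψ)) (argInstances-⊆ φs ψs (⊆P ∘ suc))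

  below-argInstances : ∀ {k h z} (φs ψs : Vec Form k) →
                       All (λ γ → z ≤₆ eval PP6H h γ) (argInstances φs ψs) →
                       z ≤₆ fh ⊎ evals PP6H h φs ≡ evals PP6H h ψs
  below-argInstances []       []       _      = inj₂ refl
  below-argInstances (φ ∷ φs) (ψ ∷ ψs) bounds
    with ++⁻ (instances φ ψ) bounds
  ... | head , tail with below-separates (≤₆-instances head) | below-argInstances φs ψs tail
  ...   | inj₁ z≤fh | _          = inj₁ z≤fh
  ...   | inj₂ _    | inj₁ z≤fh  = inj₁ z≤fh
  ...   | inj₂ φ≡ψ  | inj₂ φs≡ψs = inj₂ (cong₂ _∷_ φ≡ψ φs≡ψs)

  congruent : ∀ o φs ψs →
              (λ χ → Σ (Fin (arity o)) λ i → (Ξ ⟨ lookup φs i , lookup ψs i ⟩) χ)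
                ⊢* Ξ ⟨ app o φs , app o ψs ⟩
  congruent o φs ψs _ (ξ , Ξξ , refl) =
    ⊢-intro (sub (pair (app o φs) (app o ψs)) ξ)
            (argInstances φs ψs) (argInstances-⊆ φs ψs λ i m → i , m) λ h bounds →
      [ ≤₆fh⇒≤₆
      , (λ φs≡ψs → ≤₆-trans (≤₆-th _) (diagonal-instance Ξξ (cong (Algebra.op PP6H o) φs≡ψs)))
      ]′ (below-argInstances φs ψs bounds)

  isEquivalenceSet : IsEquivalenceSet Ξ
  isEquivalenceSet = reflexive , detachment , congruent

ξs₁ ξs₂ : List (Fm (Fin 2))
ξs₁ = (X ⇒' Y) ∷ (Y ⇒' X) ∷ ∘' (X ⇒' Y) ∷ ∘' (Y ⇒' X) ∷ []
ξs₂ = Δ' (X ⇒' Y) ∷ Δ' (Y ⇒' X) ∷ []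

Ξ₁≐ξs₁ : Ξ₁ ≐ (_∈ ξs₁)
Ξ₁≐ξs₁ = (λ { (inj₁ refl)               → here refl
            ; (inj₂ (inj₁ refl))        → there (here refl)
            ; (inj₂ (inj₂ (inj₁ refl))) → there (there (here refl))
            ; (inj₂ (inj₂ (inj₂ refl))) → there (there (there (here refl))) })
       , (λ { (here refl)                         → inj₁ refl
            ; (there (here refl))                 → inj₂ (inj₁ refl)
            ; (there (there (here refl)))         → inj₂ (inj₂ (inj₁ refl))
            ; (there (there (there (here refl)))) → inj₂ (inj₂ (inj₂ refl)) })

Ξ₂≐ξs₂ : Ξ₂ ≐ (_∈ ξs₂)
Ξ₂≐ξs₂ = (λ { (inj₁ refl) → here refl ; (inj₂ refl) → there (here refl) })
       , (λ { (here refl) → inj₁ refl ; (there (here refl)) → inj₂ refl })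

indicator₁ : IsEqualityIndicator ξs₁
indicator₁ = from-yes (isEqualityIndicator? ξs₁)

indicator₂ : IsEqualityIndicator ξs₂
indicator₂ = from-yes (isEqualityIndicator? ξs₂)

Ξ₁-isEquivalenceSet : IsEquivalenceSet Ξ₁
Ξ₁-isEquivalenceSet = EquivalenceSet.isEquivalenceSet Ξ₁≐ξs₁ indicator₁

Ξ₂-isEquivalenceSet : IsEquivalenceSet Ξ₂
Ξ₂-isEquivalenceSet = EquivalenceSet.isEquivalenceSet Ξ₂≐ξs₂ indicator₂

module Algebraization {ℓ ℓ' : Level}
  (K : Algebra ℓ → Set ℓ') (E : Pred (Eqn ⊤)) (Δ : Pred (Fm (Fin 2)))
  (⊢⇔⊨ : (Γ : Pred Form) (φ : Form) → (Γ ⊢ φ) ⇔ _⊨K*_ K (E [ Γ ]) (E [ ｛ φ ｝ ]))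
  (x≈y⊨E[Δ] : _⊨K*_ K (λ e → e ≡ (var 0 , var 1)) (E [ Δ ⟨x,y⟩]))
  (E[Δ]⊨x≈y : _⊨K*_ K (E [ Δ ⟨x,y⟩]) (λ e → e ≡ (var 0 , var 1))) where

  x : Form
  x = var 0

  lhs rhs : Eqn ⊤ → Form
  lhs ε = proj₁ (substEqn x ε)
  rhs ε = proj₂ (substEqn x ε)

  derive : ∀ Γ φ → (∀ ε → E ε → _⊨K_ K (E [ Γ ]) (substEqn φ ε)) → Γ ⊢ φ
  derive Γ φ E[Γ]⊨E[φ] =
    Equivalence.from (⊢⇔⊨ Γ φ) λ { _ (_ , refl , ε , Eε , refl) → E[Γ]⊨E[φ] ε Eε }

  consequence : ∀ {Γ ε} φ → Γ ⊢ φ → E ε → _⊨K_ K (E [ Γ ]) (substEqn φ ε)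
  consequence {Γ} {ε} φ Γ⊢φ Eε = Equivalence.to (⊢⇔⊨ Γ φ) Γ⊢φ _ (φ , refl , ε , Eε , refl)

  ⊢Δ-reflexive : ∀ {δ} → Δ δ → ∅ ⊢ sub (pair x x) δ
  ⊢Δ-reflexive {δ} Δδ = derive ∅ (sub (pair x x) δ) λ ε Eε A KA h _ →
    substEqn-respects A (sub (pair (var 0) (var 1)) δ) (sub (pair x x) δ) ε
      (eval-pair-cong A refl refl δ)
      (x≈y⊨E[Δ] _ (δ , Δδ , ε , Eε , refl) A KA (λ _ → h 0) λ { _ _ refl → refl })

  ⊢-replace : ∀ {Γ} φ ψ χ → _⊨K_ K (E [ Γ ]) (φ , ψ) →
              ∅ ⊢ sub (pair φ φ) χ → Γ ⊢ sub (pair φ ψ) χ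
  ⊢-replace {Γ} φ ψ χ Γ⊨φ≈ψ ⊢χφφ = derive Γ (sub (pair φ ψ) χ) λ ε Eε A KA h hyp →
    substEqn-respects A (sub (pair φ φ) χ) (sub (pair φ ψ) χ) ε
      (eval-pair-cong A refl (Γ⊨φ≈ψ A KA h hyp) χ)
      (consequence (sub (pair φ φ) χ) ⊢χφφ Eε A KA h λ { _ _ (_ , () , _) })

  Δ[E] : Pred Form
  Δ[E] γ = Σ (Fm (Fin 2)) λ δ → Δ δ × Σ (Eqn ⊤) λ ε → E ε × (γ ≡ sub (pair (lhs ε) (rhs ε)) δ)

  Δ[E]⊢x : Δ[E] ⊢ x
  Δ[E]⊢x = derive Δ[E] x λ ε Eε A KA h hyp →
    let g : ℕ → Algebra.Carrier A
        g = λ { ℕ.zero → eval A h (lhs ε) ; (ℕ.suc _) → eval A h (rhs ε) }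
    in E[Δ]⊨x≈y _ refl A KA g λ { _ _ (δ , Δδ , ε′ , Eε′ , refl) →
         substEqn-respects A (sub (pair (lhs ε) (rhs ε)) δ) (sub (pair (var 0) (var 1)) δ) ε′
           (eval-pair-cong A refl refl δ)
           (hyp _ _ (_ , (δ , Δδ , ε , Eε , refl) , ε′ , Eε′ , refl)) }

  open EqualityIndicator indicator₂ using (⊢conj-diagonal; below-separates)

  at-n : ℕ → V6
  at-n _ = n

  E-holds-at-n : ∀ {ε} → E ε → eval PP6H at-n (lhs ε) ≡ eval PP6H at-n (rhs ε)
  E-holds-at-n {ε} Eε = [ (λ ()) , id ]′ (below-separates n≤conj)
    where
    instance-at-x : Form
    instance-at-x = sub (pair (lhs ε) (rhs ε)) (conj ξs₂)

    x⊢instance : ｛ x ｝ ⊢ instance-at-x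
    x⊢instance = ⊢-replace (lhs ε) (rhs ε) (conj ξs₂)
                           (λ A KA h hyp → hyp _ _ (x , refl , ε , Eε , refl))
                           (⊢conj-diagonal (lhs ε))

    n≤instance : n ≤₆ eval PP6H at-n instance-at-x
    n≤instance = ⊢-lowerBound instance-at-x x⊢instance at-n λ { refl → tt }

    n≤conj : n ≤₆ ⟦ conj ξs₂ ⟧ (eval PP6H at-n (lhs ε)) (eval PP6H at-n (rhs ε))
    n≤conj = subst (n ≤₆_) (eval-instance {φ = lhs ε} {ψ = rhs ε} (conj ξs₂)) n≤instance

  Δ[E]-top-at-n : ∀ {γ} → Δ[E] γ → th ≤₆ eval PP6H at-n γ
  Δ[E]-top-at-n (δ , Δδ , ε , Eε , refl) =
    subst (th ≤₆_) (sym (eval-pair-cong PP6H {g = λ _ → c} refl (sym (E-holds-at-n Eε)) δ))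
          (⊢-lowerBound (sub (pair x x) δ) (⊢Δ-reflexive Δδ) (λ _ → c) λ ())
    where c = eval PP6H at-n (lhs ε)

  absurd : ⊥
  absurd = ⊢-lowerBound x Δ[E]⊢x at-n Δ[E]-top-at-n

not-algebraizable : ∀ ℓ ℓ' → ¬ Algebraizable ℓ ℓ'
not-algebraizable ℓ ℓ' (K , E , Δ , ⊢⇔⊨ , x≈y⊨E[Δ] , E[Δ]⊨x≈y) =
  Algebraization.absurd K E Δ ⊢⇔⊨ x≈y⊨E[Δ] E[Δ]⊨x≈y

proposition5p9 : (ℓ ℓ' : Level) →
    Equivalential × IsEquivalenceSet Ξ₁ × IsEquivalenceSet Ξ₂ × ¬ Algebraizable ℓ ℓ'
proposition5p9 ℓ ℓ' =
  (Ξ₁ , Ξ₁-isEquivalenceSet) , Ξ₁-isEquivalenceSet , Ξ₂-isEquivalenceSet , not-algebraizable ℓ ℓ'
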